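{- Let $G$ be a connected graph with node set $V$, $n=|V|$, and let $r$ be a ranking of $V$. Consider a function $f$ such that $f(v,\ell)$ can be evaluated for any $v\in V$ and $\ell\le e(v)$. Consider the following procedure $\mathrm{argminecc}$, which uses a lower certificate $L\subseteq V$ (initially empty, and kept between calls) together with the values $e_L(v)=\max_{x\in L}d(v,x)$ (initially $0$) for all $v\in V$: repeat the following steps: select $u:=\arg\min_{v\in V} f(v,e_L(v))$; perform a one-to-all distance query from $u$ and compute $e(u)$; if $e_L(u)=e(u)$, return $u$; otherwise let $a$ be the antipode of $u$ for $r$, perform a one-to-all distance query from $a$, add $a$ to $L$, and update $e_L(v):=\max(e_L(v),d(a,v))$ for all $v\in V$. If $f(v,\cdot)$ is non-decreasing for all $v\in V$, i.e., $f(v,\ell)\le f(v,\ell')$ for $\ell\le \ell'$, then $\mathrm{argminecc}$ returns a node $u$ such that $f(u,e(u))$ is minimal and updates the lower certificate $L$ such that $e_L(u)=e(u)$ and $f(v,e_L(v))\ge f(u,e(u))$ for all $v\in V$. Moreover, it can perform $k$ computations of $\arg\min f(u,e(u))$ using $k + 2|L'|$ one-to-all distance queries and $(k+2|L'|)n$ calls to $f$, where $L'\subseteq \mathrm{antipode}_r(V)$ denotes the set of nodes added to $L$.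
   Context: Graphs are undirected and unweighted (the notions extend to weighted/directed). $d(u,v)$ is the shortest-path distance, $e(u)=\max_{v\in V}d(u,v)$ is the eccentricity of $u$. Given a ranking $r$ of the nodes, the antipode $\mathrm{antipode}_r(u)$ of $u$ is its furthest node with highest rank, i.e., $\arg\max_{v\in V}(d(u,v),r(v))$ with pairs ordered lexicographically; $\mathrm{antipode}_r(V)=\{\mathrm{antipode}_r(u): u\in V\}$ is the set of antipodes. A one-to-all distance query from $u$ (e.g., a BFS) returns $d(u,v)$ for all $v\in V$. -}

module Defs where

open import Level using (Level)
open import Data.Nat using (ℕ; zero; suc; _+_; _*_; _≤_; _<_; _⊔_)
open import Data.Fin using (Fin; zero; suc; _≟_)
open import Data.Bool using (Bool; true; false; _∨_; _∧_; if_then_else_; T)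
open import Data.List using (List; []; _∷_; length)
open import Data.List.Relation.Unary.All using (All)
open import Data.List.Relation.Unary.Unique.Propositional using (Unique)
open import Data.Product using (Σ; ∃; ∃-syntax; _×_; _,_)
open import Data.Sum using (_⊎_)
open import Relation.Nullary using (¬_)
open import Relation.Nullary.Decidable using (does)
open import Relation.Binary.PropositionalEquality using (_≡_; _≢_)
open import Relation.Binary.Bundles using (TotalOrder)

record Graph (n : ℕ) : Set where
  field
    adj    : Fin n → Fin n → Bool
    sym    : ∀ u v → adj u v ≡ adj v u
    irrefl : ∀ u → adj u u ≡ false

anyFin : ∀ {n} → (Fin n → Bool) → Bool
anyFin {zero}  p = false
anyFin {suc n} p = p zero ∨ anyFin (λ i → p (suc i))

maxFin : ∀ {n} → (Fin n → ℕ) → ℕ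
maxFin {zero}  g = 0
maxFin {suc n} g = g zero ⊔ maxFin (λ i → g (suc i))

maxList : ∀ {n} → List (Fin n) → (Fin n → ℕ) → ℕ
maxList []      g = 0
maxList (x ∷ L) g = g x ⊔ maxList L g

-- least k with p k, searching k = start, start+1, ..., start+bound-1;
-- returns start+bound if none is found
firstTrue : (ℕ → Bool) → ℕ → ℕ → ℕ
firstTrue p k zero      = k
firstTrue p k (suc b)   = if p k then k else firstTrue p (suc k) b

module _ {n : ℕ} (G : Graph n) where
  open Graph G

  reach : ℕ → Fin n → Fin n → Bool
  reach zero    u v = does (u ≟ v)
  reach (suc k) u v = reach k u v ∨ anyFin (λ w → adj u w ∧ reach k w v)

  Connected : Set
  Connected = ∀ u v → ∃[ k ] T (reach k u v)

  -- shortest-path distance d(u,v): least k such that v is reachable from u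
  -- by a walk of at most k edges (in a connected graph this is < n)
  dist : Fin n → Fin n → ℕ
  dist u v = firstTrue (λ k → reach k u v) 0 n

  ecc : Fin n → ℕ
  ecc u = maxFin (dist u)

  IsAntipode : (Fin n → ℕ) → Fin n → Fin n → Set
  IsAntipode r u a = ∀ v → (dist u v < dist u a) ⊎ (dist u v ≡ dist u a × r v ≤ r a)

-- O   : totally ordered codomain of f
--   r   : the ranking (higher value = higher rank)
--   f   : the function f(v, ℓ)
--   sel : the tie-breaking rule realising  argmin_v g(v)
--         (the theorem quantifies over every sel returning an argmin)

module Alg {c ℓ₁ ℓ₂ : Level} (O : TotalOrder c ℓ₁ ℓ₂) {n : ℕ} (G : Graph n)
           (r : Fin n → ℕ) (f : Fin n → ℕ → TotalOrder.Carrier O)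
           (sel : (Fin n → TotalOrder.Carrier O) → Fin n) where

  open TotalOrder O using (Carrier) renaming (_≤_ to _≼_)

  record State : Set where
    field
      L       : List (Fin n)
      eL      : Fin n → ℕ
      queries : ℕ
      fcalls  : ℕ
  open State public

  init : State
  init = record { L = [] ; eL = λ _ → 0 ; queries = 0 ; fcalls = 0 }

  selected : State → Fin n
  selected s = sel (λ v → f v (eL s v))

  -- outcome of a returning iteration: one query from u, n calls to f
  finish : State → State
  finish s = record s { queries = suc (queries s) ; fcalls = n + fcalls s }

  -- outcome of a non-returning iteration with antipode a:
  -- queries from u and from a, n calls to f, a added to L, e_L updated
  update : State → Fin n → State
  update s a = record
    { L       = a ∷ L s
    ; eL      = λ v → eL s v ⊔ dist G a v
    ; queries = 2 + queries s
    ; fcalls  = n + fcalls s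
    }

  -- Call s u s' : argminecc started in state s returns u, ending in state s'
  data Call (s : State) : Fin n → State → Set where
    found  : ∀ {u} → u ≡ selected s → eL s u ≡ ecc G u → Call s u (finish s)
    refine : ∀ {u a u' s'} → u ≡ selected s → eL s u ≢ ecc G u →
             IsAntipode G r u a → Call (update s a) u' s' → Call s u' s'

  data Calls : ℕ → State → Set where
    none : Calls 0 init
    more : ∀ {k s u s'} → Calls k s → Call s u s' → Calls (suc k) s'

  Correct : Fin n → State → Set ℓ₂
  Correct u s' =
      (∀ v → f u (ecc G u) ≼ f v (ecc G v))
    × eL s' u ≡ ecc G u
    × (∀ v → f u (ecc G u) ≼ f v (eL s' v))

  -- cost accounting after k calls: L' = L (L starts empty) is a set of
  -- antipodes, k + 2|L'| queries, at most (k + 2|L'|) n calls to f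
  Costs : ℕ → State → Set
  Costs k s =
      queries s ≡ k + 2 * length (L s)
    × fcalls s ≤ (k + 2 * length (L s)) * n
    × All (λ a → ∃[ u ] IsAntipode G r u a) (L s)
    × Unique (L s)

-- Every returned node u is certified: e_L(u) = e(u), and e_L(v) ≤ e(v) for all v
-- because L only records true distances; monotonicity of f then makes
-- f(u, e(u)) = min_v f(v, e_L(v)) a lower bound for every f(v, e(v)).  When the
-- certificate fails at u, the antipode a of u satisfies d(a, u) = e(u) > e_L(u),
-- so a is new to L and adding it strictly decreases Σ_v (e(v) − e_L(v)); hence
-- every call terminates, and each iteration costs one query from u, one from a
-- and n calls to f.
module Submission where

open import Defs
open import Level using (Level)
open import Data.Nat using (ℕ; zero; suc; _+_; _*_; _∸_; _≤_; _<_; _⊔_; z≤n; _≟_)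
open import Data.Nat.Properties
open import Data.Nat.Induction using (<-wellFounded)
open import Induction.WellFounded using (Acc; acc)
open import Data.Fin using (Fin; zero; suc)
import Data.Fin as Fin
open import Data.Bool using (Bool; true; false; _∧_; T)
open import Data.Bool.Properties using (T-∨; T-∧)
open import Data.List using (List; []; _∷_; length)
open import Data.List.Relation.Unary.All using (All; []; _∷_)
open import Data.List.Relation.Unary.All.Properties.Core using (¬Any⇒All¬)
open import Data.List.Relation.Unary.Any using (here; there)
open import Data.List.Relation.Unary.AllPairs.Core using ([]; _∷_)
open import Data.List.Membership.Propositional using (_∈_)
open import Data.Product using (∃; ∃-syntax; _×_; _,_)
open import Data.Sum using (_⊎_; inj₁; inj₂)
open import Data.Empty using (⊥-elim)
open import Function.Bundles using (_⇔_; mk⇔; Equivalence)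
open import Relation.Nullary using (¬_; yes; no)
open import Relation.Nullary.Decidable using (toWitness; fromWitness; isYes≗does)
open import Relation.Binary.PropositionalEquality
  using (_≡_; _≢_; refl; sym; trans; cong; subst; module ≡-Reasoning)
open import Relation.Binary.Bundles using (TotalOrder)
open import Relation.Binary.Definitions using (tri<; tri≈; tri>)
open import Function.Definitions using (Injective)

open Equivalence using (to; from)

T-ext : ∀ {x y} → (T x → T y) → (T y → T x) → x ≡ y
T-ext {false} {false} _ _ = refl
T-ext {false} {true}  _ g = ⊥-elim (g _)
T-ext {true}  {false} f _ = ⊥-elim (f _)
T-ext {true}  {true}  _ _ = refl

T-anyFin : ∀ {n} {p : Fin n → Bool} → T (anyFin p) ⇔ (∃[ i ] T (p i))
T-anyFin = mk⇔ anyFin⁻ (λ (i , pi) → anyFin⁺ i pi)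
  where
  anyFin⁻ : ∀ {n} {p : Fin n → Bool} → T (anyFin p) → ∃[ i ] T (p i)
  anyFin⁻ {suc n} {p} t with to (T-∨ {p zero}) t
  ... | inj₁ p₀ = zero , p₀
  ... | inj₂ ps with anyFin⁻ ps
  ...   | i , pi = suc i , pi
  anyFin⁺ : ∀ {n} {p : Fin n → Bool} i → T (p i) → T (anyFin p)
  anyFin⁺ {p = p} zero    pi = from (T-∨ {p zero}) (inj₁ pi)
  anyFin⁺ {p = p} (suc i) pi = from (T-∨ {p zero}) (inj₂ (anyFin⁺ i pi))

firstTrue-cong : ∀ {p q : ℕ → Bool} → (∀ k → p k ≡ q k) →
                 ∀ k b → firstTrue p k b ≡ firstTrue q k b
firstTrue-cong         p≗q k zero    = refl
firstTrue-cong {q = q} p≗q k (suc b) rewrite p≗q k with q k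
... | true  = refl
... | false = firstTrue-cong p≗q (suc k) b

≤-maxFin : ∀ {n} (g : Fin n → ℕ) i → g i ≤ maxFin g
≤-maxFin g zero    = m≤m⊔n _ _
≤-maxFin g (suc i) = ≤-trans (≤-maxFin (λ j → g (suc j)) i) (m≤n⊔m (g zero) _)

maxFin-lub : ∀ {n} (g : Fin n → ℕ) {b} → (∀ i → g i ≤ b) → maxFin g ≤ b
maxFin-lub {zero}  g g≤b = z≤n
maxFin-lub {suc n} g g≤b = ⊔-lub (g≤b zero) (maxFin-lub (λ j → g (suc j)) (λ j → g≤b (suc j)))

∈⇒≤-maxList : ∀ {n} {L : List (Fin n)} (g : Fin n → ℕ) {x} → x ∈ L → g x ≤ maxList L g
∈⇒≤-maxList g (here refl) = m≤m⊔n _ _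
∈⇒≤-maxList {L = y ∷ L} g (there x∈L) = ≤-trans (∈⇒≤-maxList g x∈L) (m≤n⊔m (g y) _)

maxList-lub : ∀ {n} (L : List (Fin n)) (g : Fin n → ℕ) {b} → (∀ x → g x ≤ b) → maxList L g ≤ b
maxList-lub []      g g≤b = z≤n
maxList-lub (x ∷ L) g g≤b = ⊔-lub (g≤b x) (maxList-lub L g g≤b)

sumFin : ∀ {n} → (Fin n → ℕ) → ℕ
sumFin {zero}  g = 0
sumFin {suc n} g = g zero + sumFin (λ i → g (suc i))

sumFin-mono-≤ : ∀ {n} {g h : Fin n → ℕ} → (∀ i → g i ≤ h i) → sumFin g ≤ sumFin h
sumFin-mono-≤ {zero}  g≤h = z≤n
sumFin-mono-≤ {suc n} g≤h = +-mono-≤ (g≤h zero) (sumFin-mono-≤ (λ i → g≤h (suc i)))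

sumFin-mono-< : ∀ {n} {g h : Fin n → ℕ} → (∀ i → g i ≤ h i) → ∀ j → g j < h j →
                sumFin g < sumFin h
sumFin-mono-< g≤h zero    g<h = +-mono-<-≤ g<h (sumFin-mono-≤ (λ i → g≤h (suc i)))
sumFin-mono-< g≤h (suc j) g<h = +-mono-≤-< (g≤h zero) (sumFin-mono-< (λ i → g≤h (suc i)) j g<h)

LexLeq : ∀ {m} (h r : Fin m → ℕ) → Fin m → Fin m → Set
LexLeq h r v a = (h v < h a) ⊎ (h v ≡ h a × r v ≤ r a)

module _ {m} (h r : Fin m → ℕ) where

  lexLeq-refl : ∀ x → LexLeq h r x x
  lexLeq-refl x = inj₂ (refl , ≤-refl)

  lexLeq⇒≤ : ∀ {x y} → LexLeq h r x y → h x ≤ h y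
  lexLeq⇒≤ (inj₁ x<y)       = <⇒≤ x<y
  lexLeq⇒≤ (inj₂ (x≡y , _)) = ≤-reflexive x≡y

  lexLeq-trans : ∀ {x y z} → LexLeq h r x y → LexLeq h r y z → LexLeq h r x z
  lexLeq-trans (inj₁ x<y)        (inj₁ y<z)        = inj₁ (<-trans x<y y<z)
  lexLeq-trans (inj₁ x<y)        (inj₂ (y≡z , _))  = inj₁ (<-≤-trans x<y (≤-reflexive y≡z))
  lexLeq-trans (inj₂ (x≡y , _))  (inj₁ y<z)        = inj₁ (≤-<-trans (≤-reflexive x≡y) y<z)
  lexLeq-trans (inj₂ (x≡y , rx)) (inj₂ (y≡z , ry)) = inj₂ (trans x≡y y≡z , ≤-trans rx ry)

  lexLeq-total : ∀ x y → LexLeq h r x y ⊎ LexLeq h r y x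
  lexLeq-total x y with <-cmp (h x) (h y)
  ... | tri< x<y _ _ = inj₁ (inj₁ x<y)
  ... | tri> _ _ y<x = inj₂ (inj₁ y<x)
  ... | tri≈ _ x≡y _ with ≤-total (r x) (r y)
  ...   | inj₁ rx≤ry = inj₁ (inj₂ (x≡y , rx≤ry))
  ...   | inj₂ ry≤rx = inj₂ (inj₂ (sym x≡y , ry≤rx))

lexArgmax : ∀ {m} (h r : Fin m → ℕ) → Fin m → ∃[ a ] ∀ v → LexLeq h r v a
lexArgmax {suc zero}    h r _ = zero , λ { zero → lexLeq-refl h r zero }
lexArgmax {suc (suc m)} h r _ with lexArgmax (λ i → h (suc i)) (λ i → r (suc i)) zero
... | a , max with lexLeq-total h r zero (suc a)
...   | inj₁ 0≤a = suc a , λ { zero → 0≤a ; (suc v) → max v }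
...   | inj₂ a≤0 = zero , λ { zero → lexLeq-refl h r zero
                            ; (suc v) → lexLeq-trans h r (max v) a≤0 }

module _ {n : ℕ} (G : Graph n) where
  open Graph G

  reach-zero : ∀ {u v} → T (reach G 0 u v) ⇔ u ≡ v
  reach-zero {u} {v} =
    subst (λ b → T b ⇔ u ≡ v) (isYes≗does (u Fin.≟ v)) (mk⇔ toWitness fromWitness)

  reach-refl : ∀ u → T (reach G 0 u u)
  reach-refl u = from (reach-zero {u} {u}) refl

  reach-suc : ∀ {k u v} → T (reach G k u v) → T (reach G (suc k) u v)
  reach-suc t = from T-∨ (inj₁ t)

  reach-cons : ∀ {k u w v} → T (adj u w) → T (reach G k w v) → T (reach G (suc k) u v)
  reach-cons {k} {u} {w} {v} uw wv =
    from (T-∨ {reach G k u v}) (inj₂ (from (T-anyFin {p = λ x → adj u x ∧ reach G k x v}) (w , from T-∧ (uw , wv))))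

  reach-snoc : ∀ k {u w v} → T (reach G k u w) → T (adj w v) → T (reach G (suc k) u v)
  reach-snoc zero {u} {w} {v} uw wv with to (reach-zero {u} {w}) uw
  ... | refl = reach-cons {0} wv (reach-refl v)
  reach-snoc (suc k) {u} {w} {v} uw wv with to (T-∨ {reach G k u w}) uw
  ... | inj₁ uw′ = reach-suc {suc k} {u} {v} (reach-snoc k uw′ wv)
  ... | inj₂ ∃x with to (T-anyFin {p = λ x → adj u x ∧ reach G k x w}) ∃x
  ...   | x , ux∧xw with to (T-∧ {adj u x}) ux∧xw
  ...     | ux , xw = reach-cons {suc k} {u} {x} {v} ux (reach-snoc k xw wv)

  reach-sym : ∀ k {u v} → T (reach G k u v) → T (reach G k v u)
  reach-sym zero {u} {v} uv with to (reach-zero {u} {v}) uv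
  ... | refl = reach-refl u
  reach-sym (suc k) {u} {v} uv with to (T-∨ {reach G k u v}) uv
  ... | inj₁ uv′ = reach-suc {k} {v} {u} (reach-sym k uv′)
  ... | inj₂ ∃x with to (T-anyFin {p = λ x → adj u x ∧ reach G k x v}) ∃x
  ...   | x , ux∧xv with to (T-∧ {adj u x}) ux∧xv
  ...     | ux , xv = reach-snoc k {v} {x} {u} (reach-sym k xv) (subst T (Graph.sym G u x) ux)

  dist-sym : ∀ u v → dist G u v ≡ dist G v u
  dist-sym u v = firstTrue-cong (λ k → T-ext (reach-sym k) (reach-sym k)) 0 n

  dist≤ecc : ∀ u v → dist G u v ≤ ecc G u
  dist≤ecc u = ≤-maxFin (dist G u)

  dist≤eccʳ : ∀ u v → dist G u v ≤ ecc G v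
  dist≤eccʳ u v = subst (_≤ ecc G v) (dist-sym v u) (dist≤ecc v u)

  antipode-exists : (r : Fin n → ℕ) → ∀ u → ∃ (IsAntipode G r u)
  antipode-exists r u = lexArgmax (dist G u) r u

  antipode-dist≡ecc : ∀ {r u a} → IsAntipode G r u a → dist G u a ≡ ecc G u
  antipode-dist≡ecc {r} {u} {a} max =
    ≤-antisym (dist≤ecc u a) (maxFin-lub (dist G u) (λ v → lexLeq⇒≤ (dist G u) r (max v)))

queries-step : ∀ k len {q} → q ≡ k + 2 * len → 2 + q ≡ k + 2 * suc len
queries-step k len refl = begin
  2 + (k + 2 * len)   ≡⟨ sym (+-assoc 2 k _) ⟩
  2 + k + 2 * len     ≡⟨ cong (_+ 2 * len) (+-comm 2 k) ⟩
  k + 2 + 2 * len     ≡⟨ +-assoc k 2 _ ⟩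
  k + (2 + 2 * len)   ≡⟨ cong (k +_) (sym (*-suc 2 len)) ⟩
  k + 2 * suc len     ∎
  where open ≡-Reasoning

module Analysis {c ℓ₁ ℓ₂ : Level} (O : TotalOrder c ℓ₁ ℓ₂) {n : ℕ} (G : Graph n)
  (r : Fin n → ℕ) (f : Fin n → ℕ → TotalOrder.Carrier O)
  (sel : (Fin n → TotalOrder.Carrier O) → Fin n) where
  open Alg O G r f sel
  open TotalOrder O using () renaming (_≤_ to _≼_; trans to ≼-trans)

  record Exact (s : State) : Set where
    field eL≡maxList : ∀ v → eL s v ≡ maxList (L s) (λ x → dist G x v)
  open Exact

  init-exact : Exact init
  init-exact .eL≡maxList v = refl

  finish-exact : ∀ {s} → Exact s → Exact (finish s)
  finish-exact exact .eL≡maxList = eL≡maxList exact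

  update-exact : ∀ {s} a → Exact s → Exact (update s a)
  update-exact {s} a exact .eL≡maxList v = begin
    eL s v ⊔ dist G a v                            ≡⟨ cong (_⊔ dist G a v) (eL≡maxList exact v) ⟩
    maxList (L s) (λ x → dist G x v) ⊔ dist G a v  ≡⟨ ⊔-comm _ (dist G a v) ⟩
    maxList (a ∷ L s) (λ x → dist G x v)           ∎
    where open ≡-Reasoning

  eL≤ecc : ∀ {s} → Exact s → ∀ v → eL s v ≤ ecc G v
  eL≤ecc {s} exact v = subst (_≤ ecc G v) (sym (eL≡maxList exact v))
    (maxList-lub (L s) _ (λ x → dist≤eccʳ G x v))

  antipode-gain : ∀ {s u a} → Exact s → eL s u ≢ ecc G u → IsAntipode G r u a →
                  eL s u < dist G a u
  antipode-gain {s} {u} {a} exact uncertified antipode =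
    subst (eL s u <_) (sym (trans (dist-sym G a u) (antipode-dist≡ecc G antipode)))
      (≤∧≢⇒< (eL≤ecc exact u) uncertified)

  antipode∉L : ∀ {s u a} → Exact s → eL s u ≢ ecc G u → IsAntipode G r u a → ¬ a ∈ L s
  antipode∉L {s} {u} exact uncertified antipode a∈L =
    <⇒≱ (antipode-gain exact uncertified antipode)
      (subst (_ ≤_) (sym (eL≡maxList exact u)) (∈⇒≤-maxList (λ x → dist G x u) a∈L))

  record Invariant (k : ℕ) (s : State) : Set where
    constructor invariant
    field
      costs : Costs k s
      exact : Exact s

  finish-invariant : ∀ {k s} → Invariant k s → Invariant (suc k) (finish s)
  finish-invariant (invariant (q , fc , antipodes , unique) exact) =
    invariant (cong suc q , +-monoʳ-≤ n fc , antipodes , unique) (finish-exact exact)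

  update-invariant : ∀ {k s u a} → Invariant k s → eL s u ≢ ecc G u → IsAntipode G r u a →
                     Invariant k (update s a)
  update-invariant {k} {s} {u} {a} (invariant (q , fc , antipodes , unique) exact)
                   uncertified antipode = invariant
    ( queries-step k len q
    , subst (λ m → n + fcalls s ≤ m * n) (queries-step k len refl)
        (+-monoʳ-≤ n (≤-trans fc (m≤n+m _ n)))
    , (u , antipode) ∷ antipodes
    , ¬Any⇒All¬ (L s) (antipode∉L exact uncertified antipode) ∷ unique )
    (update-exact a exact)
    where len = length (L s)

  call-invariant : ∀ {k s u s′} → Invariant k s → Call s u s′ → Invariant (suc k) s′
  call-invariant inv (found _ _) = finish-invariant inv
  call-invariant inv (refine _ uncertified antipode call) =
    call-invariant (update-invariant inv uncertified antipode) call

  calls-invariant : ∀ {k s} → Calls k s → Invariant k s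
  calls-invariant none           = invariant (refl , z≤n , [] , []) init-exact
  calls-invariant (more cs call) = call-invariant (calls-invariant cs) call

  module _ (f-mono : ∀ v ℓ ℓ′ → ℓ ≤ ℓ′ → ℓ′ ≤ ecc G v → f v ℓ ≼ f v ℓ′)
           (sel-min : ∀ (g : Fin n → TotalOrder.Carrier O) v → g (sel g) ≼ g v) where

    call-correct : ∀ {s u s′} → Exact s → Call s u s′ → Correct u s′
    call-correct {s} {u} exact (found refl certified) =
      (λ v → ≼-trans (lower-bound v) (f-mono v _ _ (eL≤ecc exact v) ≤-refl))
      , certified , lower-bound
      where
      lower-bound : ∀ v → f u (ecc G u) ≼ f v (eL s v)
      lower-bound v = subst (λ ℓ → f u ℓ ≼ f v (eL s v)) certified
                        (sel-min (λ w → f w (eL s w)) v)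
    call-correct exact (refine {a = a} _ _ _ call) = call-correct (update-exact a exact) call

  gap : State → ℕ
  gap s = sumFin (λ v → ecc G v ∸ eL s v)

  update-gap-< : ∀ {s u a} → Exact s → eL s u ≢ ecc G u → IsAntipode G r u a →
                 gap (update s a) < gap s
  update-gap-< {s} {u} {a} exact uncertified antipode =
    sumFin-mono-< (λ v → ∸-monoʳ-≤ (ecc G v) (m≤m⊔n (eL s v) _)) u
      (∸-monoʳ-< (<-≤-trans (antipode-gain exact uncertified antipode) (m≤n⊔m _ _))
                 (⊔-lub (eL≤ecc exact u) (dist≤eccʳ G a u)))

  call-exists : ∀ s → Exact s → Acc _<_ (gap s) → ∃[ u ] ∃[ s′ ] Call s u s′
  call-exists s exact (acc smaller) with eL s (selected s) ≟ ecc G (selected s)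
  ... | yes certified = selected s , finish s , found refl certified
  ... | no uncertified with antipode-exists G r (selected s)
  ...   | a , antipode with call-exists (update s a) (update-exact a exact)
                            (smaller (update-gap-< exact uncertified antipode))
  ...     | u , s′ , call = u , s′ , refine refl uncertified antipode call

proposition1 : ∀ {c ℓ₁ ℓ₂ : Level} (O : TotalOrder c ℓ₁ ℓ₂) (n : ℕ) (G : Graph n) →
    Connected G →
    (r : Fin n → ℕ) → Injective _≡_ _≡_ r →
    (f : Fin n → ℕ → TotalOrder.Carrier O) →
    (∀ v ℓ ℓ′ → ℓ ≤ ℓ′ → ℓ′ ≤ ecc G v → TotalOrder._≤_ O (f v ℓ) (f v ℓ′)) →
    (sel : (Fin n → TotalOrder.Carrier O) → Fin n) →
    (∀ (g : Fin n → TotalOrder.Carrier O) (v : Fin n) → TotalOrder._≤_ O (g (sel g)) (g v)) →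
    (k : ℕ) (s : Alg.State O G r f sel) → Alg.Calls O G r f sel k s →
      (∃[ u ] ∃[ s′ ] Alg.Call O G r f sel s u s′)
      × (∀ u s′ → Alg.Call O G r f sel s u s′ → Alg.Correct O G r f sel u s′)
      × Alg.Costs O G r f sel k s
proposition1 O n G _ r _ f f-mono sel sel-min k s calls =
    call-exists s exact (<-wellFounded (gap s))
  , (λ _ _ → call-correct f-mono sel-min exact)
  , costs
  where
  open Analysis O G r f sel
  open Invariant (calls-invariant calls)
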